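{- For every matroid $M$ and every $t\in\mathbb{N}$, $bw(M^t)\leq t(bw(M)-1)+1$.
   Context: A cyclic flat of a matroid $M$ is a flat $F$ such that $M|F$ has no coloops; $\mathcal{Z}(M)$ denotes the set of cyclic flats, and a matroid is determined by its cyclic flats and their ranks. The $t$-expansion: fix $t\in\mathbb{N}$; for each $e\in E(M)$ let $S_e$ be a $t$-element set with $e\in S_e$, the sets $S_e$ pairwise disjoint; for $X\subseteq E(M)$ let $S_X=\bigcup_{e\in X}S_e$. The $t$-expansion $M^t$ is the matroid on $S_{E(M)}$ whose cyclic flats are exactly the sets $S_A$ with $A\in\mathcal{Z}(M)$, with $r_{M^t}(S_A)=t\cdot r_M(A)$. For $X\subseteq E(M)$ let $\overline{X}=E(M)-X$ and $\lambda_M(X)=r(X)+r(\overline{X})-r(M)$. A branch-decomposition of $M$ is a tree $T$ whose non-leaf vertices all have degree $3$, with an injection from $E(M)$ into the leaves of $T$; each edge $e$ displays the partition $(X,\overline{X})$ given by the labels on leaves of the two components of $T-e$, and has width $\lambda_M(X)+1$. The width of a branch-decomposition is its maximum edge width, and $bw(M)$ is the minimum width over all branch-decompositions of $M$. -}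

module Defs where

open import Data.Nat using (ℕ; zero; suc; _+_; _*_; _∸_; _≤_; _<_)
open import Data.Fin using (Fin; zero; suc; inject₁; fromℕ; quotient)
open import Data.Fin.Subset using (Subset; _∈_; _∉_; _⊆_; _∪_; _∩_; ∁; _-_; ⁅_⁆; ∣_∣; ⊤; ⊥)
open import Data.Vec using (tabulate; lookup)
open import Data.Bool using (Bool; true; false)
open import Data.Product using (Σ; _×_; _,_; ∃)
import Data.Sum
open import Relation.Nullary using (¬_)
open import Relation.Binary.PropositionalEquality using (_≡_)
open import Function.Definitions using (Injective)

record Matroid (n : ℕ) : Set where
  field
    rank       : Subset n → ℕ
    rank-bound : ∀ X → rank X ≤ ∣ X ∣
    rank-mono  : ∀ {X Y} → X ⊆ Y → rank X ≤ rank Y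
    rank-submod : ∀ X Y → rank (X ∪ Y) + rank (X ∩ Y) ≤ rank X + rank Y
open Matroid public

module _ {n : ℕ} (M : Matroid n) where

  IsFlat : Subset n → Set
  IsFlat F = ∀ e → e ∉ F → rank M F < rank M (F ∪ ⁅ e ⁆)

  NoColoopsRestr : Subset n → Set
  NoColoopsRestr F = ∀ e → e ∈ F → rank M (F - e) ≡ rank M F

  IsCyclicFlat : Subset n → Set
  IsCyclicFlat F = IsFlat F × NoColoopsRestr F

  conn : Subset n → ℕ
  conn X = rank M X + rank M (∁ X) ∸ rank M ⊤

-- t-expansion.  The ground set S_{E(M)} of M^t is encoded as Fin (n * t);
-- the element k belongs to the block S_e with e = quotient t k.
-- For X ⊆ E(M), S_X is the union of the blocks S_e, e ∈ X.

S[_] : ∀ {n} t → Subset n → Subset (n * t)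
S[ t ] X = tabulate (λ k → lookup X (quotient t k))

IsExpansion : ∀ {n} → Matroid n → (t : ℕ) → Matroid (n * t) → Set
IsExpansion {n} M t N =
  (∀ Z → IsCyclicFlat N Z → Σ (Subset n) λ A → IsCyclicFlat M A × Z ≡ S[ t ] A) ×
  (∀ A → IsCyclicFlat M A → IsCyclicFlat N (S[ t ] A) × rank N (S[ t ] A) ≡ t * rank M A)

record SimpleGraph (v : ℕ) : Set where
  field
    adj       : Fin v → Fin v → Bool
    adj-sym   : ∀ x y → adj x y ≡ true → adj y x ≡ true
    adj-irrefl : ∀ x → adj x x ≡ false
open SimpleGraph public

module _ {v : ℕ} (G : SimpleGraph v) where

  degree : Fin v → ℕ
  degree x = ∣ tabulate (adj G x) ∣

  data Reach : Fin v → Fin v → Set where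
    here : ∀ {x} → Reach x x
    step : ∀ {x y z} → Reach x y → adj G y z ≡ true → Reach x z

  data ReachAvoid (a b : Fin v) : Fin v → Fin v → Set where
    here : ∀ {x} → ReachAvoid a b x x
    step : ∀ {x y z} → ReachAvoid a b x y → adj G y z ≡ true →
           ¬ (y ≡ a × z ≡ b) → ¬ (y ≡ b × z ≡ a) → ReachAvoid a b x z

  Connected : Set
  Connected = ∀ x y → Reach x y

  record Cycle : Set where
    field
      k      : ℕ
      c      : Fin (suc (suc (suc k))) → Fin v
      c-inj  : Injective _≡_ _≡_ c
      c-adj  : ∀ (i : Fin (suc (suc k))) → adj G (c (inject₁ i)) (c (suc i)) ≡ true
      c-close : adj G (c (fromℕ (suc (suc k)))) (c zero) ≡ true

  IsTree : Set
  IsTree = Connected × ¬ Cycle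

record BranchDecomposition {n : ℕ} (M : Matroid n) : Set where
  field
    v      : ℕ
    T      : SimpleGraph v
    tree   : IsTree T
    degrees : ∀ x → degree T x ≡ 1 Data.Sum.⊎ degree T x ≡ 3
    label   : Fin n → Fin v
    label-inj  : Injective _≡_ _≡_ label
    label-leaf : ∀ e → degree T (label e) ≡ 1
open BranchDecomposition public

module _ {n : ℕ} {M : Matroid n} (D : BranchDecomposition M) where

  -- For an edge ab of T, X is the set of elements labelling leaves in the
  -- component of T - ab containing a.
  Displays : Fin (v D) → Fin (v D) → Subset n → Set
  Displays a b X = ∀ e → (e ∈ X → ReachAvoid (T D) a b a (label D e))
                       × (ReachAvoid (T D) a b a (label D e) → e ∈ X)

  WidthAtMost : ℕ → Set
  WidthAtMost w = ∀ a b → adj (T D) a b ≡ true → ∀ X → Displays a b X → conn M X + 1 ≤ w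

IsBranchWidth : ∀ {n} → Matroid n → ℕ → Set
IsBranchWidth M b =
  Σ (BranchDecomposition M) (λ D → WidthAtMost D b) ×
  (∀ (D : BranchDecomposition M) w → WidthAtMost D w → b ≤ w)

-- By the rank formula r(X) = min { r(Z) + |X - Z| : Z cyclic flat }, and since the cyclic
-- flats of M^t are the sets S_Z with Z a cyclic flat of M, r(S_X) = t r(X) and hence
-- λ(S_X) = t λ(X).  Given a branch-decomposition of M of width b, put all of S_e at the leaf
-- of e and then separate the elements one at a time by hanging two new leaves off their leaf.
-- The original edges display sets S_X, of width t λ(X) + 1 ≤ t (b - 1) + 1.  A new edge
-- displays a subset Y of some S_e or the complement of one, and λ(Y) ≤ t λ({e}) ≤ t (b - 1):
-- either e is a loop and Y has rank 0, or S_e is independent and λ is monotone below it.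

module Submission where

open import Defs hiding (v; T; tree; degrees; label; label-inj; label-leaf)
open import Data.Nat using (ℕ; zero; suc; _+_; _*_; _∸_; _≤_; _<_; z≤n; s≤s⁻¹)
open import Data.Nat.Properties
open import Data.Fin as Fin using (Fin; zero; suc; inject₁; fromℕ; toℕ; quotient; combine; _↑ˡ_; _↑ʳ_)
import Data.Fin.Properties as Fin
open import Data.Fin.Subset
open import Data.Fin.Subset.Properties
open import Data.Vec as Vec using ([]; _∷_; tabulate; lookup; map; zipWith)
import Data.Vec.Properties as Vec
open import Data.Bool using (Bool; true; false; not; _∧_)
open import Data.Product using (Σ; ∃; _×_; _,_; proj₁; proj₂)
open import Data.Sum using (_⊎_; inj₁; inj₂)
open import Relation.Nullary using (¬_; Dec; yes; no; contradiction)
open import Relation.Nullary.Decidable using (¬?; _×-dec_)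
open import Relation.Unary using (Decidable)
open import Relation.Binary.PropositionalEquality
open import Function using (_∘_)
open import Data.List using (List; []; _∷_; allFin)
open import Data.List.Relation.Unary.All as All using (All; []; _∷_)
open import Data.List.Membership.Propositional.Properties using (∈-allFin)

private
  variable
    n : ℕ

-- Finite sets

subset-ext : {p q : Subset n} → (∀ x → lookup p x ≡ lookup q x) → p ≡ q
subset-ext {p = p} {q} h = trans (sym (Vec.tabulate∘lookup p)) (trans (Vec.tabulate-cong h) (Vec.tabulate∘lookup q))

∣p∪q∣+∣p∩q∣≡∣p∣+∣q∣ : (p q : Subset n) → ∣ p ∪ q ∣ + ∣ p ∩ q ∣ ≡ ∣ p ∣ + ∣ q ∣
∣p∪q∣+∣p∩q∣≡∣p∣+∣q∣ []          []          = refl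
∣p∪q∣+∣p∩q∣≡∣p∣+∣q∣ (true  ∷ p) (true  ∷ q) =
  cong suc (trans (+-suc _ _) (trans (cong suc (∣p∪q∣+∣p∩q∣≡∣p∣+∣q∣ p q)) (sym (+-suc _ _))))
∣p∪q∣+∣p∩q∣≡∣p∣+∣q∣ (true  ∷ p) (false ∷ q) = cong suc (∣p∪q∣+∣p∩q∣≡∣p∣+∣q∣ p q)
∣p∪q∣+∣p∩q∣≡∣p∣+∣q∣ (false ∷ p) (true  ∷ q) = trans (cong suc (∣p∪q∣+∣p∩q∣≡∣p∣+∣q∣ p q)) (sym (+-suc _ _))
∣p∪q∣+∣p∩q∣≡∣p∣+∣q∣ (false ∷ p) (false ∷ q) = ∣p∪q∣+∣p∩q∣≡∣p∣+∣q∣ p q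

∣p∪q∣≤∣p∣+∣q∣ : (p q : Subset n) → ∣ p ∪ q ∣ ≤ ∣ p ∣ + ∣ q ∣
∣p∪q∣≤∣p∣+∣q∣ p q = ≤-trans (m≤m+n _ _) (≤-reflexive (∣p∪q∣+∣p∩q∣≡∣p∣+∣q∣ p q))

Empty[p∩q]⇒∣p∣+∣q∣≤∣p∪q∣ : (p q : Subset n) → Empty (p ∩ q) → ∣ p ∣ + ∣ q ∣ ≤ ∣ p ∪ q ∣
Empty[p∩q]⇒∣p∣+∣q∣≤∣p∪q∣ {n} p q empty = begin
  ∣ p ∣ + ∣ q ∣             ≡⟨ sym (∣p∪q∣+∣p∩q∣≡∣p∣+∣q∣ p q) ⟩
  ∣ p ∪ q ∣ + ∣ p ∩ q ∣     ≡⟨ cong (λ s → ∣ p ∪ q ∣ + ∣ s ∣) (Empty-unique empty) ⟩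
  ∣ p ∪ q ∣ + ∣ ⊥ {n} ∣     ≡⟨ cong (∣ p ∪ q ∣ +_) (∣⊥∣≡0 n) ⟩
  ∣ p ∪ q ∣ + 0             ≡⟨ +-identityʳ _ ⟩
  ∣ p ∪ q ∣                 ∎
  where open ≤-Reasoning

module _ (p : Subset n) (x : Fin n) where

  ∁[p-x]⊆∁p∪⁅x⁆ : ∁ (p - x) ⊆ ∁ p ∪ ⁅ x ⁆
  ∁[p-x]⊆∁p∪⁅x⁆ {y} y∈∁ with y Fin.≟ x
  ... | yes refl = x∈p∪q⁺ (inj₂ (x∈⁅x⁆ y))
  ... | no y≢x   = x∈p∪q⁺ (inj₁ (x∉p⇒x∈∁p λ y∈p → x∈∁p⇒x∉p y∈∁ (x∈p∧x≢y⇒x∈p-y y∈p y≢x)))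

  ∁[p∪⁅x⁆]⊆∁p-x : ∁ (p ∪ ⁅ x ⁆) ⊆ ∁ p - x
  ∁[p∪⁅x⁆]⊆∁p-x y∈∁ = x∈p∧x≢y⇒x∈p-y
    (x∉p⇒x∈∁p λ y∈p → x∈∁p⇒x∉p y∈∁ (x∈p∪q⁺ (inj₁ y∈p)))
    (λ { refl → x∈∁p⇒x∉p y∈∁ (x∈p∪q⁺ (inj₂ (x∈⁅x⁆ _))) })

∩-monoʳ-⊆ : (p : Subset n) {q r : Subset n} → q ⊆ r → p ∩ q ⊆ p ∩ r
∩-monoʳ-⊆ p q⊆r y∈ = let (y∈p , y∈q) = x∈p∩q⁻ p _ y∈ in x∈p∩q⁺ (y∈p , q⊆r y∈q)

∩-distribˡ-⊆-∪ : (p : Subset n) {q r : Subset n} → p ∩ (q ∪ r) ⊆ (p ∩ q) ∪ r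
∩-distribˡ-⊆-∪ p {q} {r} y∈ with x∈p∩q⁻ p _ y∈
... | y∈p , y∈q∪r with x∈p∪q⁻ q r y∈q∪r
...   | inj₁ y∈q = x∈p∪q⁺ (inj₁ (x∈p∩q⁺ (y∈p , y∈q)))
...   | inj₂ y∈r = x∈p∪q⁺ (inj₂ y∈r)

lookup-∉ : {p : Subset n} {x : Fin n} → x ∉ p → lookup p x ≡ false
lookup-∉ {p = p} {x} x∉p with lookup p x in eq
... | true  = contradiction (Vec.lookup⇒[]= x p eq) x∉p
... | false = refl

∈-tabulate⁺ : ∀ {f : Fin n → Bool} {x} → f x ≡ true → x ∈ tabulate f
∈-tabulate⁺ {f = f} {x} fx = Vec.lookup⇒[]= x (tabulate f) (trans (Vec.lookup∘tabulate f x) fx)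

∈-tabulate⁻ : ∀ {f : Fin n → Bool} {x} → x ∈ tabulate f → f x ≡ true
∈-tabulate⁻ {f = f} {x} x∈ = trans (sym (Vec.lookup∘tabulate f x)) (Vec.[]=⇒lookup x∈)

∣p∪⁅x⁆∣≤1+∣p∣ : (p : Subset n) (x : Fin n) → ∣ p ∪ ⁅ x ⁆ ∣ ≤ suc ∣ p ∣
∣p∪⁅x⁆∣≤1+∣p∣ p x = ≤-trans (∣p∪q∣≤∣p∣+∣q∣ p ⁅ x ⁆) (≤-reflexive (trans (cong (∣ p ∣ +_) (∣⁅x⁆∣≡1 x)) (+-comm ∣ p ∣ 1)))

Empty[p∩∁p] : (p : Subset n) → Empty (p ∩ ∁ p)
Empty[p∩∁p] p (y , y∈) = let (y∈p , y∈∁p) = x∈p∩q⁻ p _ y∈ in x∈∁p⇒x∉p y∈∁p y∈p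

-- Rank and connectivity

module _ (M : Matroid n) where

  rank-∪-≤ : ∀ X Y → rank M (X ∪ Y) ≤ rank M X + ∣ Y ∣
  rank-∪-≤ X Y = begin
    rank M (X ∪ Y)                    ≤⟨ m≤m+n _ _ ⟩
    rank M (X ∪ Y) + rank M (X ∩ Y)   ≤⟨ rank-submod M X Y ⟩
    rank M X + rank M Y               ≤⟨ +-monoʳ-≤ (rank M X) (rank-bound M Y) ⟩
    rank M X + ∣ Y ∣                  ∎
    where open ≤-Reasoning

  rX≤rZ+∣X∩∁Z∣ : ∀ X Z → rank M X ≤ rank M Z + ∣ X ∩ ∁ Z ∣
  rX≤rZ+∣X∩∁Z∣ X Z = ≤-trans (rank-mono M X⊆Z∪[X∩∁Z]) (rank-∪-≤ Z (X ∩ ∁ Z))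
    where
    X⊆Z∪[X∩∁Z] : X ⊆ Z ∪ (X ∩ ∁ Z)
    X⊆Z∪[X∩∁Z] {y} y∈X with y ∈? Z
    ... | yes y∈Z = x∈p∪q⁺ (inj₁ y∈Z)
    ... | no  y∉Z = x∈p∪q⁺ (inj₂ (x∈p∩q⁺ (y∈X , x∉p⇒x∈∁p y∉Z)))

  conn-∁ : ∀ X → conn M (∁ X) ≡ conn M X
  conn-∁ X = cong (_∸ rank M ⊤) (trans (cong (rank M (∁ X) +_) (cong (rank M) ∁∁X≡X)) (+-comm (rank M (∁ X)) (rank M X)))
    where
    ∁∁X≡X : ∁ (∁ X) ≡ X
    ∁∁X≡X = ⊆-antisym (λ y∈ → x∉∁p⇒x∈p (x∈∁p⇒x∉p y∈)) (λ y∈ → x∉p⇒x∈∁p (x∈p⇒x∉∁p y∈))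

  conn≤rank : ∀ X → conn M X ≤ rank M X
  conn≤rank X = begin
    rank M X + rank M (∁ X) ∸ rank M ⊤   ≤⟨ ∸-monoʳ-≤ (rank M X + rank M (∁ X)) (rank-mono M ⊆⊤) ⟩
    rank M X + rank M (∁ X) ∸ rank M (∁ X) ≡⟨ m+n∸n≡m (rank M X) (rank M (∁ X)) ⟩
    rank M X ∎
    where open ≤-Reasoning

  conn-mono-⊆-independent : ∀ {Y Z} → Y ⊆ Z → rank M Z ≡ ∣ Z ∣ → conn M Y ≤ conn M Z
  conn-mono-⊆-independent {Y} {Z} Y⊆Z rZ≡∣Z∣ = ∸-monoˡ-≤ (rank M ⊤) (begin
    rank M Y + rank M (∁ Y)                 ≤⟨ +-mono-≤ (rank-bound M Y) (rX≤rZ+∣X∩∁Z∣ (∁ Y) (∁ Z)) ⟩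
    ∣ Y ∣ + (rank M (∁ Z) + ∣ W ∣)          ≡⟨ cong (∣ Y ∣ +_) (+-comm (rank M (∁ Z)) ∣ W ∣) ⟩
    ∣ Y ∣ + (∣ W ∣ + rank M (∁ Z))          ≡⟨ +-assoc ∣ Y ∣ ∣ W ∣ (rank M (∁ Z)) ⟨
    ∣ Y ∣ + ∣ W ∣ + rank M (∁ Z)            ≤⟨ +-monoˡ-≤ (rank M (∁ Z)) ∣Y∣+∣W∣≤∣Z∣ ⟩
    ∣ Z ∣ + rank M (∁ Z)                    ≡⟨ cong (_+ rank M (∁ Z)) rZ≡∣Z∣ ⟨
    rank M Z + rank M (∁ Z)                 ∎)
    where
    open ≤-Reasoning
    W = ∁ Y ∩ ∁ (∁ Z)
    Y∪W⊆Z : Y ∪ W ⊆ Z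
    Y∪W⊆Z y∈ with x∈p∪q⁻ Y W y∈
    ... | inj₁ y∈Y = Y⊆Z y∈Y
    ... | inj₂ y∈W = x∉∁p⇒x∈p (x∈∁p⇒x∉p (proj₂ (x∈p∩q⁻ (∁ Y) _ y∈W)))
    Y∩W-empty : Empty (Y ∩ W)
    Y∩W-empty (y , y∈) = x∈∁p⇒x∉p (proj₁ (x∈p∩q⁻ (∁ Y) _ (proj₂ (x∈p∩q⁻ Y W y∈)))) (proj₁ (x∈p∩q⁻ Y W y∈))
    ∣Y∣+∣W∣≤∣Z∣ : ∣ Y ∣ + ∣ W ∣ ≤ ∣ Z ∣
    ∣Y∣+∣W∣≤∣Z∣ = ≤-trans (Empty[p∩q]⇒∣p∣+∣q∣≤∣p∪q∣ Y W Y∩W-empty) (p⊆q⇒∣p∣≤∣q∣ Y∪W⊆Z)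

  Attains : Subset n → Subset n → Set
  Attains X Z = rank M Z + ∣ X ∩ ∁ Z ∣ ≤ rank M X

  attains-∪-spanned : ∀ {X Z e} → rank M (Z ∪ ⁅ e ⁆) ≡ rank M Z → Attains X Z → Attains X (Z ∪ ⁅ e ⁆)
  attains-∪-spanned {X} {Z} {e} r≡ attains =
    ≤-trans (+-mono-≤ (≤-reflexive r≡) (p⊆q⇒∣p∣≤∣q∣ (∩-monoʳ-⊆ X (p⊆q⇒∁p⊇∁q (p⊆p∪q _))))) attains

  attains-remove-coloop : ∀ {X Z e} → rank M (Z - e) < rank M Z → Attains X Z → Attains X (Z - e)
  attains-remove-coloop {X} {Z} {e} r< attains = begin
    rank M (Z - e) + ∣ X ∩ ∁ (Z - e) ∣        ≤⟨ +-monoʳ-≤ (rank M (Z - e)) ∣X∩∁[Z-e]∣≤ ⟩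
    rank M (Z - e) + suc ∣ X ∩ ∁ Z ∣          ≡⟨ +-suc _ _ ⟩
    suc (rank M (Z - e)) + ∣ X ∩ ∁ Z ∣        ≤⟨ +-monoˡ-≤ _ r< ⟩
    rank M Z + ∣ X ∩ ∁ Z ∣                    ≤⟨ attains ⟩
    rank M X                                  ∎
    where
    open ≤-Reasoning
    ∣X∩∁[Z-e]∣≤ : ∣ X ∩ ∁ (Z - e) ∣ ≤ suc ∣ X ∩ ∁ Z ∣
    ∣X∩∁[Z-e]∣≤ = ≤-trans (p⊆q⇒∣p∣≤∣q∣ (λ y∈ → ∩-distribˡ-⊆-∪ X (∩-monoʳ-⊆ X (∁[p-x]⊆∁p∪⁅x⁆ Z e) y∈)))
                          (∣p∪⁅x⁆∣≤1+∣p∣ (X ∩ ∁ Z) e)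

  private
    potential : Subset n → ℕ
    potential Z = 2 * rank M Z + ∣ ∁ Z ∣

  potential-∪-spanned : ∀ {Z e} → e ∉ Z → rank M (Z ∪ ⁅ e ⁆) ≡ rank M Z → potential (Z ∪ ⁅ e ⁆) < potential Z
  potential-∪-spanned {Z} {e} e∉Z r≡ = begin-strict
    2 * rank M (Z ∪ ⁅ e ⁆) + ∣ ∁ (Z ∪ ⁅ e ⁆) ∣   ≡⟨ cong (λ r → 2 * r + ∣ ∁ (Z ∪ ⁅ e ⁆) ∣) r≡ ⟩
    2 * rank M Z + ∣ ∁ (Z ∪ ⁅ e ⁆) ∣             <⟨ +-monoʳ-< (2 * rank M Z) ∣∁[Z∪⁅e⁆]∣<∣∁Z∣ ⟩
    2 * rank M Z + ∣ ∁ Z ∣                       ∎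
    where
    open ≤-Reasoning
    ∣∁[Z∪⁅e⁆]∣<∣∁Z∣ : ∣ ∁ (Z ∪ ⁅ e ⁆) ∣ < ∣ ∁ Z ∣
    ∣∁[Z∪⁅e⁆]∣<∣∁Z∣ = ≤-<-trans (p⊆q⇒∣p∣≤∣q∣ (∁[p∪⁅x⁆]⊆∁p-x Z e)) (x∈p⇒∣p-x∣<∣p∣ (x∉p⇒x∈∁p e∉Z))

  potential-remove-coloop : ∀ {Z e} → rank M (Z - e) < rank M Z → potential (Z - e) < potential Z
  potential-remove-coloop {Z} {e} r< = begin-strict
    2 * rank M (Z - e) + ∣ ∁ (Z - e) ∣        ≤⟨ +-monoʳ-≤ (2 * rank M (Z - e)) ∣∁[Z-e]∣≤ ⟩
    2 * rank M (Z - e) + suc ∣ ∁ Z ∣          ≡⟨ +-suc _ _ ⟩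
    suc (2 * rank M (Z - e) + ∣ ∁ Z ∣)        <⟨ n<1+n _ ⟩
    2 + 2 * rank M (Z - e) + ∣ ∁ Z ∣          ≡⟨ cong (_+ ∣ ∁ Z ∣) (*-suc 2 (rank M (Z - e))) ⟨
    2 * suc (rank M (Z - e)) + ∣ ∁ Z ∣        ≤⟨ +-monoˡ-≤ ∣ ∁ Z ∣ (*-monoʳ-≤ 2 r<) ⟩
    2 * rank M Z + ∣ ∁ Z ∣                    ∎
    where
    open ≤-Reasoning
    ∣∁[Z-e]∣≤ : ∣ ∁ (Z - e) ∣ ≤ suc ∣ ∁ Z ∣
    ∣∁[Z-e]∣≤ = ≤-trans (p⊆q⇒∣p∣≤∣q∣ (∁[p-x]⊆∁p∪⁅x⁆ Z e)) (∣p∪⁅x⁆∣≤1+∣p∣ (∁ Z) e)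

  -- Close up rank-preserving elements and delete coloops; the potential decreases at each move.
  cyclicFlat-attaining : ∀ X → ∃ λ Z → IsCyclicFlat M Z × Attains X Z
  cyclicFlat-attaining X = search (suc (potential X)) X ≤-refl attains-self
    where
    attains-self : Attains X X
    attains-self = ≤-reflexive (trans (cong (λ s → rank M X + ∣ s ∣) (Empty-unique (Empty[p∩∁p] X)))
                                      (trans (cong (rank M X +_) (∣⊥∣≡0 n)) (+-identityʳ _)))
    search : ∀ fuel Z → potential Z < fuel → Attains X Z → ∃ λ Z → IsCyclicFlat M Z × Attains X Z
    search (suc fuel) Z bound attains
      with Fin.any? (λ e → ¬? (e ∈? Z) ×-dec (rank M (Z ∪ ⁅ e ⁆) ≟ rank M Z))
    ... | yes (e , e∉Z , r≡) =
      search fuel (Z ∪ ⁅ e ⁆) (≤-trans (potential-∪-spanned e∉Z r≡) (s≤s⁻¹ bound)) (attains-∪-spanned r≡ attains)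
    ... | no ¬spanned with Fin.any? (λ e → (e ∈? Z) ×-dec ¬? (rank M (Z - e) ≟ rank M Z))
    ...   | yes (e , e∈Z , r≢) =
      search fuel (Z - e) (≤-trans (potential-remove-coloop r<) (s≤s⁻¹ bound)) (attains-remove-coloop r< attains)
      where r< = ≤∧≢⇒< (rank-mono M (p─q⊆p Z ⁅ e ⁆)) r≢
    ...   | no ¬coloop = Z , (flat , noColoops) , attains
      where
      flat : IsFlat M Z
      flat e e∉Z = ≤∧≢⇒< (rank-mono M (p⊆p∪q _)) λ r≡ → ¬spanned (e , e∉Z , sym r≡)
      noColoops : NoColoopsRestr M Z
      noColoops e e∈Z with rank M (Z - e) ≟ rank M Z
      ... | yes r≡ = r≡
      ... | no r≢ = contradiction (e , e∈Z , r≢) ¬coloop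

-- Expansions

module _ (t : ℕ) where

  lookup-S : (X : Subset n) (k : Fin (n * t)) → lookup (S[ t ] X) k ≡ lookup X (quotient t k)
  lookup-S X k = Vec.lookup∘tabulate _ k

  ∈-S⁺ : ∀ {X : Subset n} {k} → quotient t k ∈ X → k ∈ S[ t ] X
  ∈-S⁺ q∈X = ∈-tabulate⁺ (Vec.[]=⇒lookup q∈X)

  ∈-S⁻ : ∀ {X : Subset n} {k} → k ∈ S[ t ] X → quotient t k ∈ X
  ∈-S⁻ {X = X} k∈S = Vec.lookup⇒[]= _ X (∈-tabulate⁻ k∈S)

  S-map : ∀ f (X : Subset n) → S[ t ] (map f X) ≡ map f (S[ t ] X)
  S-map f X = subset-ext λ k → begin
    lookup (S[ t ] (map f X)) k   ≡⟨ lookup-S (map f X) k ⟩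
    lookup (map f X) (quotient t k) ≡⟨ Vec.lookup-map _ f X ⟩
    f (lookup X (quotient t k))   ≡⟨ cong f (lookup-S X k) ⟨
    f (lookup (S[ t ] X) k)       ≡⟨ Vec.lookup-map k f (S[ t ] X) ⟨
    lookup (map f (S[ t ] X)) k   ∎
    where open ≡-Reasoning

  S-zipWith : ∀ f (X Y : Subset n) → S[ t ] (zipWith f X Y) ≡ zipWith f (S[ t ] X) (S[ t ] Y)
  S-zipWith f X Y = subset-ext λ k → begin
    lookup (S[ t ] (zipWith f X Y)) k                         ≡⟨ lookup-S (zipWith f X Y) k ⟩
    lookup (zipWith f X Y) (quotient t k)                     ≡⟨ Vec.lookup-zipWith f _ X Y ⟩
    f (lookup X (quotient t k)) (lookup Y (quotient t k))     ≡⟨ cong₂ f (lookup-S X k) (lookup-S Y k) ⟨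
    f (lookup (S[ t ] X) k) (lookup (S[ t ] Y) k)             ≡⟨ Vec.lookup-zipWith f k (S[ t ] X) (S[ t ] Y) ⟨
    lookup (zipWith f (S[ t ] X) (S[ t ] Y)) k                ∎
    where open ≡-Reasoning

  S-⊤ : ∀ {n} → S[ t ] (⊤ {n}) ≡ ⊤
  S-⊤ {n} = subset-ext λ k → trans (lookup-S (⊤ {n}) k)
    (trans (Vec.lookup-replicate (quotient {n} t k) true) (sym (Vec.lookup-replicate k true)))

∣tabulate∣-++ : ∀ t m (f : Fin (t + m) → Bool) →
  ∣ tabulate f ∣ ≡ ∣ tabulate (λ i → f (i ↑ˡ m)) ∣ + ∣ tabulate (λ j → f (t ↑ʳ j)) ∣
∣tabulate∣-++ zero    m f = refl
∣tabulate∣-++ (suc t) m f with f zero | ∣tabulate∣-++ t m (λ i → f (suc i))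
... | true  | ih = cong suc ih
... | false | ih = ih

∣tabulate-const∣ : ∀ t a → ∣ tabulate {n = t} (λ _ → a) ∣ ≡ t * ∣ a ∷ [] ∣
∣tabulate-const∣ zero    a     = refl
∣tabulate-const∣ (suc t) true  = cong suc (∣tabulate-const∣ t true)
∣tabulate-const∣ (suc t) false = ∣tabulate-const∣ t false

quotient-↑ˡ : ∀ t (i : Fin t) → quotient {suc n} t (i ↑ˡ (n * t)) ≡ zero
quotient-↑ˡ {n} t i rewrite Fin.splitAt-↑ˡ t i (n * t) = refl

quotient-↑ʳ : ∀ t (j : Fin (n * t)) → quotient {suc n} t (t ↑ʳ j) ≡ suc (quotient t j)
quotient-↑ʳ {n} t j rewrite Fin.splitAt-↑ʳ t (n * t) j = refl

∣S[t]X∣≡t*∣X∣ : ∀ t (X : Subset n) → ∣ S[ t ] X ∣ ≡ t * ∣ X ∣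
∣S[t]X∣≡t*∣X∣ t [] = sym (*-zeroʳ t)
∣S[t]X∣≡t*∣X∣ {suc n} t (a ∷ X) = begin
  ∣ S[ t ] (a ∷ X) ∣
    ≡⟨ ∣tabulate∣-++ t (n * t) _ ⟩
  ∣ tabulate (λ i → lookup (a ∷ X) (quotient t (i ↑ˡ (n * t)))) ∣ + ∣ tabulate (λ j → lookup (a ∷ X) (quotient t (t ↑ʳ j))) ∣
    ≡⟨ cong₂ _+_ (cong ∣_∣ (Vec.tabulate-cong λ i → cong (lookup (a ∷ X)) (quotient-↑ˡ t i)))
                 (cong ∣_∣ (Vec.tabulate-cong λ j → cong (lookup (a ∷ X)) (quotient-↑ʳ t j))) ⟩
  ∣ tabulate {n = t} (λ _ → a) ∣ + ∣ S[ t ] X ∣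
    ≡⟨ cong₂ _+_ (∣tabulate-const∣ t a) (∣S[t]X∣≡t*∣X∣ t X) ⟩
  t * ∣ a ∷ [] ∣ + t * ∣ X ∣
    ≡⟨ *-distribˡ-+ t ∣ a ∷ [] ∣ ∣ X ∣ ⟨
  t * (∣ a ∷ [] ∣ + ∣ X ∣)
    ≡⟨ cong (t *_) (∣x∷p∣≡∣x∷[]∣+∣p∣ a X) ⟨
  t * ∣ a ∷ X ∣ ∎
  where
  open ≡-Reasoning
  ∣x∷p∣≡∣x∷[]∣+∣p∣ : ∀ x (p : Subset n) → ∣ x ∷ p ∣ ≡ ∣ x ∷ [] ∣ + ∣ p ∣
  ∣x∷p∣≡∣x∷[]∣+∣p∣ true  p = refl
  ∣x∷p∣≡∣x∷[]∣+∣p∣ false p = refl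

module _ (M : Matroid n) (t : ℕ) (N : Matroid (n * t)) (expansion : IsExpansion M t N) where

  private
    rank-S-cyclic : ∀ A → IsCyclicFlat M A → rank N (S[ t ] A) ≡ t * rank M A
    rank-S-cyclic A cyclic = proj₂ (proj₂ expansion A cyclic)

    ∣S[t]X∩∁S[t]Z∣ : ∀ (X Z : Subset n) → ∣ S[ t ] X ∩ ∁ (S[ t ] Z) ∣ ≡ t * ∣ X ∩ ∁ Z ∣
    ∣S[t]X∩∁S[t]Z∣ X Z = begin
      ∣ S[ t ] X ∩ ∁ (S[ t ] Z) ∣   ≡⟨ cong (λ s → ∣ S[ t ] X ∩ s ∣) (S-map t not Z) ⟨
      ∣ S[ t ] X ∩ S[ t ] (∁ Z) ∣   ≡⟨ cong ∣_∣ (S-zipWith t _∧_ X (∁ Z)) ⟨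
      ∣ S[ t ] (X ∩ ∁ Z) ∣          ≡⟨ ∣S[t]X∣≡t*∣X∣ t (X ∩ ∁ Z) ⟩
      t * ∣ X ∩ ∁ Z ∣               ∎
      where open ≡-Reasoning

  -- The rank formula, applied in M for upper and in N for lower.
  rank-S : ∀ X → rank N (S[ t ] X) ≡ t * rank M X
  rank-S X = ≤-antisym upper lower
    where
    open ≤-Reasoning
    upper : rank N (S[ t ] X) ≤ t * rank M X
    upper with Z , cyclic , attains ← cyclicFlat-attaining M X = begin
      rank N (S[ t ] X)                                  ≤⟨ rX≤rZ+∣X∩∁Z∣ N (S[ t ] X) (S[ t ] Z) ⟩
      rank N (S[ t ] Z) + ∣ S[ t ] X ∩ ∁ (S[ t ] Z) ∣    ≡⟨ cong₂ _+_ (rank-S-cyclic Z cyclic) (∣S[t]X∩∁S[t]Z∣ X Z) ⟩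
      t * rank M Z + t * ∣ X ∩ ∁ Z ∣                     ≡⟨ *-distribˡ-+ t (rank M Z) ∣ X ∩ ∁ Z ∣ ⟨
      t * (rank M Z + ∣ X ∩ ∁ Z ∣)                       ≤⟨ *-monoʳ-≤ t attains ⟩
      t * rank M X                                       ∎
    lower : t * rank M X ≤ rank N (S[ t ] X)
    lower with cyclicFlat-attaining N (S[ t ] X)
    ... | Z , cyclic , attains with proj₁ expansion Z cyclic
    ...   | A , cyclicA , refl = begin
      t * rank M X                                       ≤⟨ *-monoʳ-≤ t (rX≤rZ+∣X∩∁Z∣ M X A) ⟩
      t * (rank M A + ∣ X ∩ ∁ A ∣)                       ≡⟨ *-distribˡ-+ t (rank M A) ∣ X ∩ ∁ A ∣ ⟩
      t * rank M A + t * ∣ X ∩ ∁ A ∣                     ≡⟨ cong₂ _+_ (rank-S-cyclic A cyclicA) (∣S[t]X∩∁S[t]Z∣ X A) ⟨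
      rank N (S[ t ] A) + ∣ S[ t ] X ∩ ∁ (S[ t ] A) ∣    ≤⟨ attains ⟩
      rank N (S[ t ] X)                                  ∎

  conn-S : ∀ X → conn N (S[ t ] X) ≡ t * conn M X
  conn-S X = begin
    rank N (S[ t ] X) + rank N (∁ (S[ t ] X)) ∸ rank N ⊤
      ≡⟨ cong₂ (λ Y E → rank N (S[ t ] X) + rank N Y ∸ rank N E) (S-map t not X) (S-⊤ t {n}) ⟨
    rank N (S[ t ] X) + rank N (S[ t ] (∁ X)) ∸ rank N (S[ t ] (⊤ {n}))
      ≡⟨ cong₂ _∸_ (cong₂ _+_ (rank-S X) (rank-S (∁ X))) (rank-S (⊤ {n})) ⟩
    t * rank M X + t * rank M (∁ X) ∸ t * rank M ⊤
      ≡⟨ cong (_∸ t * rank M ⊤) (*-distribˡ-+ t (rank M X) (rank M (∁ X))) ⟨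
    t * (rank M X + rank M (∁ X)) ∸ t * rank M ⊤
      ≡⟨ *-distribˡ-∸ t (rank M X + rank M (∁ X)) (rank M ⊤) ⟨
    t * conn M X ∎
    where open ≡-Reasoning

  conn-⊆-S⁅e⁆ : ∀ e {Y} → Y ⊆ S[ t ] ⁅ e ⁆ → conn N Y ≤ t * conn M ⁅ e ⁆
  conn-⊆-S⁅e⁆ e {Y} Y⊆ with m≤n⇒m<n∨m≡n (≤-trans (rank-bound M ⁅ e ⁆) (≤-reflexive (∣⁅x⁆∣≡1 e)))
  ... | inj₁ r<1 = ≤-trans loop z≤n
    where
    loop : conn N Y ≤ 0
    loop = begin
      conn N Y                ≤⟨ conn≤rank N Y ⟩
      rank N Y                ≤⟨ rank-mono N Y⊆ ⟩
      rank N (S[ t ] ⁅ e ⁆)   ≡⟨ rank-S ⁅ e ⁆ ⟩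
      t * rank M ⁅ e ⁆        ≡⟨ cong (t *_) (n<1⇒n≡0 r<1) ⟩
      t * 0                   ≡⟨ *-zeroʳ t ⟩
      0                       ∎
      where open ≤-Reasoning
  ... | inj₂ r≡1 = ≤-trans (conn-mono-⊆-independent N Y⊆ independent) (≤-reflexive (conn-S ⁅ e ⁆))
    where
    independent : rank N (S[ t ] ⁅ e ⁆) ≡ ∣ S[ t ] ⁅ e ⁆ ∣
    independent = begin
      rank N (S[ t ] ⁅ e ⁆)   ≡⟨ rank-S ⁅ e ⁆ ⟩
      t * rank M ⁅ e ⁆        ≡⟨ cong (t *_) (trans r≡1 (sym (∣⁅x⁆∣≡1 e))) ⟩
      t * ∣ ⁅ e ⁆ ∣           ≡⟨ ∣S[t]X∣≡t*∣X∣ t ⁅ e ⁆ ⟨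
      ∣ S[ t ] ⁅ e ⁆ ∣        ∎
      where open ≡-Reasoning

-- Trees

reach-trans : ∀ {v} {G : SimpleGraph v} {x y z} → Reach G x y → Reach G y z → Reach G x z
reach-trans p here         = p
reach-trans p (step q yz)  = step (reach-trans p q) yz

data CyclicIndex {m : ℕ} : Fin (suc m) → Set where
  last  : CyclicIndex (fromℕ m)
  inner : (j : Fin m) → CyclicIndex (inject₁ j)

cyclicIndex : ∀ {m} (i : Fin (suc m)) → CyclicIndex i
cyclicIndex {zero}  zero    = last
cyclicIndex {suc m} zero    = inner zero
cyclicIndex {suc m} (suc i) with cyclicIndex i
... | last    = last
... | inner j = inner (suc j)

module _ {v : ℕ} {G : SimpleGraph v} (C : Cycle G) where
  open Cycle C

  cycle-two-neighbours : ∀ i → ∃ λ p → ∃ λ q → p ≢ q × adj G (c p) (c i) ≡ true × adj G (c i) (c q) ≡ true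
  cycle-two-neighbours i with cyclicIndex i
  ... | inner zero    = fromℕ (suc (suc k)) , suc zero , (λ ()) , c-close , c-adj zero
  ... | inner (suc j) = inject₁ (inject₁ j) , suc (suc j) , inject₁²≢suc² , c-adj (inject₁ j) , c-adj (suc j)
    where
    inject₁²≢suc² : inject₁ (inject₁ j) ≢ suc (suc j)
    inject₁²≢suc² eq = <⇒≢ (m<n⇒m<1+n (n<1+n (toℕ j)))
      (trans (sym (trans (Fin.toℕ-inject₁ (inject₁ j)) (Fin.toℕ-inject₁ j))) (cong toℕ eq))
  ... | last          = inject₁ (fromℕ (suc k)) , zero , (λ ()) , c-adj (fromℕ (suc k)) , c-close

-- Displays, for an arbitrary (possibly non-injective) labelling L.
Separates : ∀ {v K} → SimpleGraph v → (Fin K → Fin v) → Fin v → Fin v → Subset K → Set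
Separates G L a b X = ∀ e → (e ∈ X → ReachAvoid G a b a (L e)) × (ReachAvoid G a b a (L e) → e ∈ X)

avoid-from-leaf : ∀ {v} {G : SimpleGraph v} {ℓ p : Fin v} → (∀ z → adj G ℓ z ≡ true → z ≡ p) →
                  ∀ {y} → ReachAvoid G ℓ p ℓ y → y ≡ ℓ
avoid-from-leaf {ℓ = ℓ} only-p = go refl
  where
  go : ∀ {x y} → x ≡ ℓ → ReachAvoid _ ℓ _ x y → y ≡ ℓ
  go x≡ℓ here = x≡ℓ
  go x≡ℓ (step {z = z} r yz ¬ℓp _) with go x≡ℓ r
  ... | refl = contradiction (refl , only-p z yz) ¬ℓp

module _ {v : ℕ} (G : SimpleGraph v) {ℓ : Fin v} (leaf : degree G ℓ ≡ 1) where

  private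
    neighbours = tabulate (adj G ℓ)

    ∈-neighbours : ∀ {p} → adj G ℓ p ≡ true → p ∈ neighbours
    ∈-neighbours = ∈-tabulate⁺

  leaf-neighbour : ∃ λ p → adj G ℓ p ≡ true
  leaf-neighbour with nonempty? neighbours
  ... | yes (p , p∈) = p , ∈-tabulate⁻ p∈
  ... | no empty     = contradiction (trans (sym leaf) (trans (cong ∣_∣ (Empty-unique empty)) (∣⊥∣≡0 v))) λ ()

  leaf-neighbour-unique : ∀ {p z} → adj G ℓ p ≡ true → adj G ℓ z ≡ true → z ≡ p
  leaf-neighbour-unique {p} {z} ℓp ℓz with z Fin.≟ p
  ... | yes z≡p = z≡p
  ... | no z≢p  = contradiction (begin
    2                        ≡⟨ cong₂ _+_ (∣⁅x⁆∣≡1 p) (∣⁅x⁆∣≡1 z) ⟨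
    ∣ ⁅ p ⁆ ∣ + ∣ ⁅ z ⁆ ∣    ≤⟨ Empty[p∩q]⇒∣p∣+∣q∣≤∣p∪q∣ ⁅ p ⁆ ⁅ z ⁆ disjoint ⟩
    ∣ ⁅ p ⁆ ∪ ⁅ z ⁆ ∣        ≤⟨ p⊆q⇒∣p∣≤∣q∣ ⁅p⁆∪⁅z⁆⊆neighbours ⟩
    ∣ neighbours ∣           ≡⟨ leaf ⟩
    1                        ∎) (<-irrefl refl)
    where
    open ≤-Reasoning
    disjoint : Empty (⁅ p ⁆ ∩ ⁅ z ⁆)
    disjoint (y , y∈) = let (y∈⁅p⁆ , y∈⁅z⁆) = x∈p∩q⁻ ⁅ p ⁆ ⁅ z ⁆ y∈ in
      z≢p (trans (sym (x∈⁅y⁆⇒x≡y z y∈⁅z⁆)) (x∈⁅y⁆⇒x≡y p y∈⁅p⁆))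
    ⁅p⁆∪⁅z⁆⊆neighbours : ⁅ p ⁆ ∪ ⁅ z ⁆ ⊆ neighbours
    ⁅p⁆∪⁅z⁆⊆neighbours y∈ with x∈p∪q⁻ ⁅ p ⁆ ⁅ z ⁆ y∈
    ... | inj₁ y∈⁅p⁆ rewrite x∈⁅y⁆⇒x≡y p y∈⁅p⁆ = ∈-neighbours ℓp
    ... | inj₂ y∈⁅z⁆ rewrite x∈⁅y⁆⇒x≡y z y∈⁅z⁆ = ∈-neighbours ℓz

module AddLeaf {v : ℕ} (G : SimpleGraph v) (u : Fin v) where

  private
    adj⁺ : Fin (suc v) → Fin (suc v) → Bool
    adj⁺ zero    zero    = false
    adj⁺ zero    (suc y) = lookup ⁅ u ⁆ y
    adj⁺ (suc x) zero    = lookup ⁅ u ⁆ x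
    adj⁺ (suc x) (suc y) = adj G x y

    adj⁺-sym : ∀ x y → adj⁺ x y ≡ true → adj⁺ y x ≡ true
    adj⁺-sym zero    (suc y) xy = xy
    adj⁺-sym (suc x) zero    xy = xy
    adj⁺-sym (suc x) (suc y) xy = adj-sym G x y xy

    adj⁺-irrefl : ∀ x → adj⁺ x x ≡ false
    adj⁺-irrefl zero    = refl
    adj⁺-irrefl (suc x) = adj-irrefl G x

  G⁺ : SimpleGraph (suc v)
  G⁺ = record { adj = adj⁺ ; adj-sym = adj⁺-sym ; adj-irrefl = adj⁺-irrefl }

  retract : Fin (suc v) → Fin v
  retract zero    = u
  retract (suc y) = y

  new-edge : adj G⁺ zero (suc u) ≡ true
  new-edge = Vec.[]=⇒lookup (x∈⁅x⁆ u)

  neighbour-of-new : ∀ y → adj G⁺ zero y ≡ true → y ≡ suc u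
  neighbour-of-new (suc y) zy = cong suc (x∈⁅y⁆⇒x≡y u (Vec.lookup⇒[]= y ⁅ u ⁆ zy))

  neighbour-of-new′ : ∀ y → adj G⁺ y zero ≡ true → y ≡ suc u
  neighbour-of-new′ (suc y) yz = neighbour-of-new (suc y) yz

  degree-new : degree G⁺ zero ≡ 1
  degree-new = trans (cong ∣_∣ (Vec.tabulate∘lookup ⁅ u ⁆)) (∣⁅x⁆∣≡1 u)

  degree-attached : degree G⁺ (suc u) ≡ suc (degree G u)
  degree-attached rewrite Vec.[]=⇒lookup (x∈⁅x⁆ u) = refl

  degree-old : ∀ {x} → x ≢ u → degree G⁺ (suc x) ≡ degree G x
  degree-old {x} x≢u rewrite lookup-∉ (x≢y⇒x∉⁅y⁆ x≢u) = refl

  lift-reach : ∀ {x y} → Reach G x y → Reach G⁺ (suc x) (suc y)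
  lift-reach here        = here
  lift-reach (step p yz) = step (lift-reach p) yz

  connected⁺ : Connected G → Connected G⁺
  connected⁺ conn zero    zero    = here
  connected⁺ conn zero    (suc y) = reach-trans (step here new-edge) (lift-reach (conn u y))
  connected⁺ conn (suc x) zero    = step (lift-reach (conn x u)) new-edge
  connected⁺ conn (suc x) (suc y) = lift-reach (conn x y)

  -- The new vertex has a single neighbour, so it lies on no cycle; a cycle avoiding it is a cycle of G.
  acyclic⁺ : ¬ Cycle G → ¬ Cycle G⁺
  acyclic⁺ acyclic C with Fin.any? (λ i → Cycle.c C i Fin.≟ zero)
  ... | yes (i , cᵢ≡0) with cycle-two-neighbours C i
  ...   | p , q , p≢q , pi , iq = p≢q (Cycle.c-inj C (trans
          (neighbour-of-new′ _ (subst (λ z → adj G⁺ (Cycle.c C p) z ≡ true) cᵢ≡0 pi))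
          (sym (neighbour-of-new _ (subst (λ z → adj G⁺ z (Cycle.c C q) ≡ true) cᵢ≡0 iq)))))
  acyclic⁺ acyclic C | no avoids = acyclic record
    { k       = k
    ; c       = retract ∘ c
    ; c-inj   = λ eq → c-inj (retract-injective (avoid _) (avoid _) eq)
    ; c-adj   = λ i → trans (retract-adj (avoid _) (avoid _)) (c-adj i)
    ; c-close = trans (retract-adj (avoid _) (avoid _)) c-close
    }
    where
    open Cycle C
    avoid : ∀ i → c i ≢ zero
    avoid i cᵢ≡0 = avoids (i , cᵢ≡0)
    retract-injective : ∀ {x y} → x ≢ zero → y ≢ zero → retract x ≡ retract y → x ≡ y
    retract-injective {zero}  {_}     x≢0 _   _  = contradiction refl x≢0
    retract-injective {suc _} {zero}  _   y≢0 _  = contradiction refl y≢0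
    retract-injective {suc _} {suc _} _   _   eq = cong suc eq
    retract-adj : ∀ {x y} → x ≢ zero → y ≢ zero → adj G (retract x) (retract y) ≡ adj G⁺ x y
    retract-adj {zero}  {_}     x≢0 _   = contradiction refl x≢0
    retract-adj {suc _} {zero}  _   y≢0 = contradiction refl y≢0
    retract-adj {suc _} {suc _} _   _   = refl

  isTree⁺ : IsTree G → IsTree G⁺
  isTree⁺ (conn , acyclic) = connected⁺ conn , acyclic⁺ acyclic

  lift-avoid : ∀ {a b x y} → ReachAvoid G a b x y → ReachAvoid G⁺ (suc a) (suc b) (suc x) (suc y)
  lift-avoid here = here
  lift-avoid (step r yz ¬ab ¬ba) = step (lift-avoid r) yz
    (λ (y≡a , z≡b) → ¬ab (Fin.suc-injective y≡a , Fin.suc-injective z≡b))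
    (λ (y≡b , z≡a) → ¬ba (Fin.suc-injective y≡b , Fin.suc-injective z≡a))

  retract-avoid : ∀ {a b x y} → ReachAvoid G⁺ (suc a) (suc b) x y → ReachAvoid G a b (retract x) (retract y)
  retract-avoid here = here
  retract-avoid (step {y = zero}  {z = zero}  r _ _ _) = retract-avoid r
  retract-avoid (step {y = zero}  {z = suc z} r yz _ _)
    rewrite Fin.suc-injective (neighbour-of-new (suc z) yz) = retract-avoid r
  retract-avoid (step {y = suc y} {z = zero}  r yz _ _)
    rewrite Fin.suc-injective (neighbour-of-new′ (suc y) yz) = retract-avoid r
  retract-avoid (step {y = suc y} {z = suc z} r yz ¬ab ¬ba) = step (retract-avoid r) yz
    (λ (y≡a , z≡b) → ¬ab (cong suc y≡a , cong suc z≡b))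
    (λ (y≡b , z≡a) → ¬ba (cong suc y≡b , cong suc z≡a))

  separates-old : ∀ {K} {L : Fin K → Fin v} {L⁺ : Fin K → Fin (suc v)} → (∀ j → retract (L⁺ j) ≡ L j) →
                  ∀ {a b X} → Separates G⁺ L⁺ (suc a) (suc b) X → Separates G L a b X
  separates-old {L = L} {L⁺} retract-L⁺ {a} {b} sep j =
    (λ j∈X → subst (ReachAvoid G a b a) (retract-L⁺ j) (retract-avoid (proj₁ (sep j) j∈X))) ,
    (λ r → proj₂ (sep j) (extend (L⁺ j) (subst (ReachAvoid G a b a) (sym (retract-L⁺ j)) r)))
    where
    extend : ∀ y → ReachAvoid G a b a (retract y) → ReachAvoid G⁺ (suc a) (suc b) (suc a) y
    extend zero    r = step (lift-avoid r) new-edge (λ { (_ , ()) }) (λ { (_ , ()) })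
    extend (suc y) r = lift-avoid r

  stuck-at-new : ∀ {y} → ReachAvoid G⁺ zero (suc u) zero y → y ≡ zero
  stuck-at-new = avoid-from-leaf neighbour-of-new

  reach-avoiding-new : Connected G → ∀ y → y ≢ zero → ReachAvoid G⁺ (suc u) zero (suc u) y
  reach-avoiding-new conn zero    y≢0 = contradiction refl y≢0
  reach-avoiding-new conn (suc y) _   = lift (conn u y)
    where
    lift : ∀ {x y} → Reach G x y → ReachAvoid G⁺ (suc u) zero (suc x) (suc y)
    lift here        = here
    lift (step p yz) = step (lift p) yz (λ { (_ , ()) }) (λ { (() , _) })

-- Separating labels

module Splitting {K : ℕ} {B : Set} (block : Fin K → B) (Good : Subset K → Set)
  (good-within-block : ∀ {Y} b → (∀ {j} → j ∈ Y → block j ≡ b) → Good Y)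
  (good-∁ : ∀ {Y} → Good (∁ Y) → Good Y) where

  record LabelledTree : Set where
    field
      order       : ℕ
      graph       : SimpleGraph order
      tree        : IsTree graph
      label       : Fin K → Fin order
      label-block : ∀ {i j} → label i ≡ label j → block i ≡ block j
      width       : ∀ a b → adj graph a b ≡ true → ∀ X → Separates graph label a b X → Good X

  module Sprout (P : LabelledTree) (u : Fin (LabelledTree.order P)) {S : Fin K → Set} (S? : Decidable S)
    (S-at-u : ∀ {j} → S j → LabelledTree.label P j ≡ u) (b : B) (S-in-b : ∀ {j} → S j → block j ≡ b) where

    open LabelledTree P
    open AddLeaf graph u

    label⁺ : Fin K → Fin (suc order)
    label⁺ j with S? j
    ... | yes _ = zero
    ... | no  _ = suc (label j)

    label⁺-∉ : ∀ {j} → ¬ S j → label⁺ j ≡ suc (label j)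
    label⁺-∉ {j} ¬Sj with S? j
    ... | yes Sj = contradiction Sj ¬Sj
    ... | no  _  = refl

    label⁺-∈ : ∀ {j} → S j → label⁺ j ≡ zero
    label⁺-∈ {j} Sj with S? j
    ... | yes _   = refl
    ... | no ¬Sj  = contradiction Sj ¬Sj

    label⁺-new : ∀ {j} → label⁺ j ≡ zero → S j
    label⁺-new {j} eq with S? j
    ... | yes Sj = Sj

    retract-label⁺ : ∀ j → retract (label⁺ j) ≡ label j
    retract-label⁺ j with S? j
    ... | yes Sj = sym (S-at-u Sj)
    ... | no  _  = refl

    label⁺-reflects : ∀ {i j} → label⁺ i ≡ label⁺ j → label i ≡ label j
    label⁺-reflects {i} {j} eq = trans (sym (retract-label⁺ i)) (trans (cong retract eq) (retract-label⁺ j))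

    inside-new-side : ∀ {y X} → adj G⁺ zero y ≡ true → Separates G⁺ label⁺ zero y X → ∀ {j} → j ∈ X → S j
    inside-new-side {y} zy sep {j} j∈X = label⁺-new (stuck-at-new
      (subst (λ z → ReachAvoid G⁺ zero z zero (label⁺ j)) (neighbour-of-new y zy) (proj₁ (sep j) j∈X)))

    outside-old-side : ∀ {x X} → adj G⁺ (suc x) zero ≡ true → Separates G⁺ label⁺ (suc x) zero X → ∀ {j} → j ∉ X → S j
    outside-old-side {x} xz sep {j} j∉X with label⁺ j Fin.≟ zero
    ... | yes at-new  = label⁺-new at-new
    ... | no ¬at-new = contradiction (proj₂ (sep j)
            (subst (λ z → ReachAvoid G⁺ z zero z (label⁺ j)) (sym (neighbour-of-new′ (suc x) xz))
                   (reach-avoiding-new (proj₁ tree) (label⁺ j) ¬at-new))) j∉X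

    width⁺ : ∀ x y → adj G⁺ x y ≡ true → ∀ X → Separates G⁺ label⁺ x y X → Good X
    width⁺ zero    y       xy X sep = good-within-block b (S-in-b ∘ inside-new-side xy sep)
    width⁺ (suc x) zero    xy X sep = good-∁ (good-within-block b (S-in-b ∘ outside-old-side xy sep ∘ x∈∁p⇒x∉p))
    width⁺ (suc x) (suc y) xy X sep = width x y xy X (separates-old retract-label⁺ sep)

    sprouted : LabelledTree
    sprouted = record
      { order = suc order ; graph = G⁺ ; tree = isTree⁺ tree ; label = label⁺
      ; label-block = label-block ∘ label⁺-reflects ; width = width⁺ }

  record Decomposition : Set where
    field
      labelled   : LabelledTree
    open LabelledTree labelled public
    field
      degrees    : ∀ x → degree graph x ≡ 1 ⊎ degree graph x ≡ 3
      label-leaf : ∀ j → degree graph (label j) ≡ 1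

  Isolated : Decomposition → Fin K → Set
  Isolated D k = ∀ j → Decomposition.label D j ≡ Decomposition.label D k → j ≡ k

  -- Two new leaves hang off the leaf ℓ of k: one takes k, the other the remaining elements at ℓ.
  module Isolate (D : Decomposition) (k : Fin K) where

    open Decomposition D
    private
      ℓ = label k
      module A₁ = AddLeaf graph ℓ
      module A₂ = AddLeaf A₁.G⁺ (suc ℓ)

      Shares : Fin K → Set
      Shares j = j ≢ k × label j ≡ ℓ

      shares? : Decidable Shares
      shares? j = ¬? (j Fin.≟ k) ×-dec (label j Fin.≟ ℓ)

      shares-block : ∀ {j} → Shares j → block j ≡ block k
      shares-block (_ , eq) = label-block eq

      module First = Sprout labelled ℓ shares? proj₂ (block k) shares-block

      k-at-suc-ℓ : ∀ {j} → j ≡ k → First.label⁺ j ≡ suc ℓ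
      k-at-suc-ℓ refl = First.label⁺-∉ λ (k≢k , _) → k≢k refl

      module Second = Sprout First.sprouted (suc ℓ) (Fin._≟ k) k-at-suc-ℓ (block k) (cong block)

      degree-old : ∀ {w} → w ≢ ℓ → degree A₂.G⁺ (suc (suc w)) ≡ degree graph w
      degree-old w≢ℓ = trans (A₂.degree-old (w≢ℓ ∘ Fin.suc-injective)) (A₁.degree-old w≢ℓ)

      degree-first-new : degree A₂.G⁺ (suc zero) ≡ 1
      degree-first-new = trans (A₂.degree-old {zero} λ ()) A₁.degree-new

      degrees₂ : ∀ x → degree A₂.G⁺ x ≡ 1 ⊎ degree A₂.G⁺ x ≡ 3
      degrees₂ zero          = inj₁ A₂.degree-new
      degrees₂ (suc zero)    = inj₁ degree-first-new
      degrees₂ (suc (suc w)) with w Fin.≟ ℓ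
      ... | yes refl = inj₂ (trans A₂.degree-attached (cong suc (trans A₁.degree-attached (cong suc (label-leaf k)))))
      ... | no w≢ℓ   = subst (λ d → d ≡ 1 ⊎ d ≡ 3) (sym (degree-old w≢ℓ)) (degrees w)

      label-leaf₂ : ∀ j → degree A₂.G⁺ (Second.label⁺ j) ≡ 1
      label-leaf₂ j = by-cases (j Fin.≟ k) (label j Fin.≟ ℓ)
        where
        by-cases : Dec (j ≡ k) → Dec (label j ≡ ℓ) → degree A₂.G⁺ (Second.label⁺ j) ≡ 1
        by-cases (yes j≡k) _ rewrite Second.label⁺-∈ j≡k = A₂.degree-new
        by-cases (no j≢k) (yes shares) rewrite Second.label⁺-∉ j≢k | First.label⁺-∈ (j≢k , shares) =
          degree-first-new
        by-cases (no j≢k) (no ¬shares) rewrite Second.label⁺-∉ j≢k | First.label⁺-∉ (¬shares ∘ proj₂) =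
          trans (degree-old ¬shares) (label-leaf j)

    isolated : Decomposition
    isolated = record
      { labelled = Second.sprouted ; degrees = degrees₂ ; label-leaf = label-leaf₂ }

    isolates : Isolated isolated k
    isolates j eq = Second.label⁺-new (trans eq (Second.label⁺-∈ refl))

    preserves : ∀ {j} → Isolated D j → Isolated isolated j
    preserves isolatedʲ i eq = isolatedʲ i (First.label⁺-reflects (Second.label⁺-reflects eq))

  isolate-list : Decomposition → (ks : List (Fin K)) → Σ Decomposition λ D → All (Isolated D) ks
  isolate-list D []       = D , []
  isolate-list D (k ∷ ks) with isolate-list D ks
  ... | D′ , isolated = Isolate.isolated D′ k , Isolate.isolates D′ k ∷ All.map (Isolate.preserves D′ k) isolated

  isolate-all : Decomposition → Σ Decomposition λ D → ∀ k → Isolated D k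
  isolate-all D with isolate-list D (allFin K)
  ... | D′ , isolated = D′ , λ k → All.lookup isolated (∈-allFin k)

-- Branch-decompositions of the expansion

separates-respects-label : ∀ {v K} {G : SimpleGraph v} {L : Fin K → Fin v} {a b X} →
  Separates G L a b X → ∀ {i j} → L i ≡ L j → i ∈ X → j ∈ X
separates-respects-label {G = G} {a = a} {b} sep {i} {j} Lᵢ≡Lⱼ i∈X =
  proj₂ (sep j) (subst (ReachAvoid G a b a) Lᵢ≡Lⱼ (proj₁ (sep i) i∈X))

module _ (t : ℕ) {v} {T : SimpleGraph v} (L : Fin n → Fin v) {a b} {X : Subset (n * suc t)}
         (sep : Separates T (L ∘ quotient (suc t)) a b X) where

  private
    representative : Fin n → Fin (n * suc t)
    representative e = combine e zero

    quotient-representative : ∀ e → quotient (suc t) (representative e) ≡ e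
    quotient-representative e = cong proj₁ (Fin.remQuot-combine e zero)

  blocks : Subset n
  blocks = tabulate (λ e → lookup X (representative e))

  private
    ∈-blocks⁺ : ∀ {e} → representative e ∈ X → e ∈ blocks
    ∈-blocks⁺ {e} r∈X = ∈-tabulate⁺ {f = λ e → lookup X (representative e)} (Vec.[]=⇒lookup r∈X)

    ∈-blocks⁻ : ∀ {e} → e ∈ blocks → representative e ∈ X
    ∈-blocks⁻ {e} e∈ = Vec.lookup⇒[]= _ X (∈-tabulate⁻ {f = λ e → lookup X (representative e)} e∈)

    same-label : ∀ j → L (quotient (suc t) (representative (quotient (suc t) j))) ≡ L (quotient (suc t) j)
    same-label j = cong L (quotient-representative (quotient (suc t) j))

  separates-blocks : Separates T L a b blocks
  separates-blocks e =
    (λ e∈ → subst (ReachAvoid T a b a ∘ L) (quotient-representative e) (proj₁ (sep _) (∈-blocks⁻ e∈))) ,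
    (λ r → ∈-blocks⁺ (proj₂ (sep _) (subst (ReachAvoid T a b a ∘ L) (sym (quotient-representative e)) r)))

  ≡S[blocks] : X ≡ S[ suc t ] blocks
  ≡S[blocks] = ⊆-antisym
    (λ {j} j∈X → ∈-S⁺ (suc t) (∈-blocks⁺ (separates-respects-label sep (sym (same-label j)) j∈X)))
    (λ {j} j∈S → separates-respects-label sep (same-label j) (∈-blocks⁻ (∈-S⁻ (suc t) j∈S)))

module _ {n} {M : Matroid n} (D : BranchDecomposition M) where
  open BranchDecomposition D

  leaf-edge-separates : ∀ e → ∃ λ p → adj T (label e) p ≡ true × Separates T label (label e) p ⁅ e ⁆
  leaf-edge-separates e with leaf-neighbour T (label-leaf e)
  ... | p , ℓp = p , ℓp , λ e′ →
    (λ e′∈ → subst (ReachAvoid T (label e) p (label e) ∘ label) (sym (x∈⁅y⁆⇒x≡y e e′∈)) here) ,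
    (λ r → subst (_∈ ⁅ e ⁆) (sym (label-inj (avoid-from-leaf only-p r))) (x∈⁅x⁆ e))
    where
    only-p : ∀ z → adj T (label e) z ≡ true → z ≡ p
    only-p z ℓz = leaf-neighbour-unique T (label-leaf e) ℓp ℓz

  width-⁅e⁆ : ∀ {b} → WidthAtMost D b → ∀ e → conn M ⁅ e ⁆ ≤ b ∸ 1
  width-⁅e⁆ width e with leaf-edge-separates e
  ... | p , ℓp , sep = m+n≤o⇒m≤o∸n _ (width (label e) p ℓp ⁅ e ⁆ sep)

module _ {n} {M : Matroid n} (t′ : ℕ) {N : Matroid (n * suc t′)} (expansion : IsExpansion M (suc t′) N)
         {b} (D : BranchDecomposition M) (D≤b : WidthAtMost D b) where

  private
    t = suc t′
    module D = BranchDecomposition D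

  Narrow : Subset (n * t) → Set
  Narrow Y = conn N Y ≤ t * (b ∸ 1)

  narrow-within-block : ∀ {Y} e → (∀ {j} → j ∈ Y → quotient t j ≡ e) → Narrow Y
  narrow-within-block e within = ≤-trans
    (conn-⊆-S⁅e⁆ M t N expansion e λ j∈Y → ∈-S⁺ t (subst (_∈ ⁅ e ⁆) (sym (within j∈Y)) (x∈⁅x⁆ e)))
    (*-monoʳ-≤ t (width-⁅e⁆ D D≤b e))

  narrow-∁ : ∀ {Y} → Narrow (∁ Y) → Narrow Y
  narrow-∁ {Y} = subst (_≤ t * (b ∸ 1)) (conn-∁ N Y)

  open Splitting (quotient t) Narrow narrow-within-block narrow-∁

  initial : Decomposition
  initial = record
    { labelled = record
      { order = D.v ; graph = D.T ; tree = D.tree ; label = D.label ∘ quotient t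
      ; label-block = D.label-inj ; width = width-initial }
    ; degrees = D.degrees ; label-leaf = D.label-leaf ∘ quotient t }
    where
    width-initial : ∀ x y → adj D.T x y ≡ true → ∀ X → Separates D.T (D.label ∘ quotient t) x y X → Narrow X
    width-initial x y xy X sep = begin
      conn N X             ≡⟨ cong (conn N) (≡S[blocks] t′ D.label sep) ⟩
      conn N (S[ t ] Xₘ)   ≡⟨ conn-S M t N expansion Xₘ ⟩
      t * conn M Xₘ        ≤⟨ *-monoʳ-≤ t (m+n≤o⇒m≤o∸n _ (D≤b x y xy Xₘ (separates-blocks t′ D.label sep))) ⟩
      t * (b ∸ 1)          ∎
      where
      open ≤-Reasoning
      Xₘ = blocks t′ D.label sep

  expanded-decomposition : Σ (BranchDecomposition N) λ D′ → WidthAtMost D′ (t * (b ∸ 1) + 1)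
  expanded-decomposition with isolate-all initial
  ... | D′ , isolated = record
    { v = order ; T = graph ; tree = tree ; degrees = degrees ; label = label
    ; label-inj = λ {i} {j} eq → isolated j i eq ; label-leaf = label-leaf } ,
    λ x y xy X sep → +-monoˡ-≤ 1 (width x y xy X sep)
    where open Decomposition D′

theorem6p1 : ∀ {n} (M : Matroid n) (t : ℕ) → 1 ≤ t →
    (N : Matroid (n * t)) → IsExpansion M t N →
    ∀ b b′ → IsBranchWidth M b → IsBranchWidth N b′ →
    b′ ≤ t * (b ∸ 1) + 1
theorem6p1 M (suc t′) _ N expansion b b′ ((D , D≤b) , _) (_ , minimal) =
  minimal (proj₁ D′) _ (proj₂ D′)
  where D′ = expanded-decomposition t′ expansion D D≤b
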